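{- Let $n\ge 0$ and let $i\ge j\ge 0$ be integers with $i+j\le n$ and $i+j\equiv n \pmod 2$. Let $$\mathcal{M}^{(2)}_{n,i;j}=\{(P,Q): P,Q \text{ paths of length } n,\ -P\le Q\le P,\ h(P)=i+j,\ h(Q)=i-j\},$$ $$\mathcal{P}^{(2)}_{n,i;j}=\{(P,Q): P,Q \text{ paths of length } n,\ 0\le Q\le P,\ i-j\le h(Q)\le i+j\le h(P)\}.$$ Then the map $\varphi$ (defined in the context) is a bijection from $\mathcal{M}^{(2)}_{n,i;j}$ onto $\mathcal{P}^{(2)}_{n,i;j}$.
   Context: A path of length $n$ is a lattice path in $\mathbb{Z}^2$ starting at $(0,0)$ with $n$ steps, each $U=(1,1)$ or $D=(1,-1)$. For $0\le a\le n$, $h_a(P)$ is the $y$-coordinate of $P$ at $x=a$, and $h(P)=h_n(P)$. We write $Q\le P$ if $h_a(Q)\le h_a(P)$ for all $a$; $0\le Q$ means $h_a(Q)\ge 0$ for all $a$; $-P$ is the reflection of $P$ in the $x$-axis. Flipping a step means changing it from $U$ to $D$ or vice versa. For paths $P,Q$ of length $n$, the disagreement path $(P-Q)/2$ is the path with steps $U$, $D$, $H=(1,0)$ whose height at each $a$ is $(h_a(P)-h_a(Q))/2$ (its $l$-th step is $U$ if $P$ has $U$ and $Q$ has $D$ there, $D$ if $P$ has $D$ and $Q$ has $U$, and $H$ if they agree). Matching in a path with steps $U,D,H$: ignoring $H$ steps and reading left to right, regard each $U$ as an opening parenthesis and each $D$ as a closing parenthesis, and match each $D$ with the nearest preceding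 not-yet-matched $U$, if one exists (equivalently, a $U$ and a $D$ are matched when they face each other at the same height with the path staying above the segment joining their midpoints). Steps $U$ or $D$ not matched are called unmatched. The map $\varphi$: given $(P,Q)\in\mathcal{M}^{(2)}_{n,i;j}$, (1) let $Q'$ be the path obtained from $Q$ by flipping every step of $Q$ whose endpoint lies strictly below the $x$-axis; (2) let $\chi$ be the set of positions of the unmatched $D$ steps of $(P-Q')/2$, and let $\widetilde P,\widetilde Q$ be obtained from $P$ and $Q'$ respectively by flipping the steps in positions $\chi$. Then $\varphi(P,Q)=(\widetilde P,\widetilde Q)$. -}

module Defs where

open import Data.Bool using (Bool; true; false; not; if_then_else_)
open import Data.Nat using (ℕ; zero; suc)
open import Data.Integer using (ℤ; +_; _+_; _-_; -_; _≤_; _<?_)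
open import Relation.Nullary.Decidable using (does)
open import Relation.Binary.PropositionalEquality using (_≡_)
open import Data.Fin using (Fin; zero; suc; fromℕ)
open import Data.Vec using (Vec; []; _∷_)
open import Data.Product using (_×_; _,_)

-- A path of length n: a vector of steps, true = U = (1,1), false = D = (1,-1).
Path : ℕ → Set
Path n = Vec Bool n

stepH : Bool → ℤ
stepH true  = + 1
stepH false = - (+ 1)

hAt : ∀ {n} → Path n → Fin (suc n) → ℤ
hAt P        zero    = + 0
hAt (b ∷ P)  (suc a) = stepH b + hAt P a

h : ∀ {n} → Path n → ℤ
h {n} P = hAt P (fromℕ n)

_≤ₚ_ : ∀ {n} → Path n → Path n → Set
Q ≤ₚ P = ∀ a → hAt Q a ≤ hAt P a

NonNeg : ∀ {n} → Path n → Set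
NonNeg Q = ∀ a → + 0 ≤ hAt Q a

NegBelow : ∀ {n} → Path n → Path n → Set
NegBelow P Q = ∀ a → - hAt P a ≤ hAt Q a

-- Step (1) of φ: flip every step whose endpoint lies strictly below the x-axis.
-- The accumulator c is the height of Q at the start of the current step.
flipBelowFrom : ∀ {n} → ℤ → Path n → Path n
flipBelowFrom c []      = []
flipBelowFrom c (b ∷ Q) =
  (if does ((c + stepH b) <? + 0) then not b else b) ∷ flipBelowFrom (c + stepH b) Q

flipBelow : ∀ {n} → Path n → Path n
flipBelow = flipBelowFrom (+ 0)

-- Step (2) of φ: scan the disagreement path (P - Q')/2 left to right, with k the
-- number of currently unmatched U steps (P has U, Q' has D). A D step (P has D,
-- Q' has U) is matched iff k > 0; unmatched D steps are flipped in both paths.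
flipUnmatchedD : ∀ {n} → ℕ → Path n → Path n → Path n × Path n
flipUnmatchedD k []      []      = [] , []
flipUnmatchedD k (true ∷ P)  (false ∷ Q) with flipUnmatchedD (suc k) P Q
... | P' , Q' = true ∷ P' , false ∷ Q'
flipUnmatchedD zero (false ∷ P) (true ∷ Q) with flipUnmatchedD zero P Q
... | P' , Q' = true ∷ P' , false ∷ Q'
flipUnmatchedD (suc k) (false ∷ P) (true ∷ Q) with flipUnmatchedD k P Q
... | P' , Q' = false ∷ P' , true ∷ Q'
flipUnmatchedD k (true ∷ P)  (true ∷ Q) with flipUnmatchedD k P Q
... | P' , Q' = true ∷ P' , true ∷ Q'
flipUnmatchedD k (false ∷ P) (false ∷ Q) with flipUnmatchedD k P Q
... | P' , Q' = false ∷ P' , false ∷ Q'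

φ : ∀ {n} → Path n → Path n → Path n × Path n
φ P Q = flipUnmatchedD 0 P (flipBelow Q)

InM : (n i j : ℕ) → Path n → Path n → Set
InM n i j P Q = NegBelow P Q × Q ≤ₚ P × h P ≡ + i + + j × h Q ≡ + i - + j

InP : (n i j : ℕ) → Path n → Path n → Set
InP n i j P Q = NonNeg Q × Q ≤ₚ P × + i - + j ≤ h Q × h Q ≤ + i + + j × + i + + j ≤ h P

module Submission where

open import Data.Bool using (Bool; true; false; not; if_then_else_)
open import Data.Bool.Properties using (not-involutive)
open import Data.Fin using (Fin; zero; suc; fromℕ)
open import Data.Integer using (ℤ; +_; -[1+_]; _+_; _-_; -_; ∣_∣; _≤_; _<?_; +≤+; -≤+)
import Data.Integer.Properties as ℤ
open import Data.Nat as ℕ using (ℕ; zero; suc; _*_; _%_; _/_; _∸_)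
open import Data.Nat.DivMod using (m≡m%n+[m/n]*n; [m+kn]%n≡m%n; /-monoˡ-≤)
import Data.Nat.Properties as ℕ
open import Data.Product using (Σ; ∃-syntax; _×_; _,_; proj₁; proj₂)
open import Data.Vec using ([]; _∷_)
open import Algebra.Properties.AbelianGroup ℤ.+-0-abelianGroup using (∙-cancelˡ)
open import Algebra.Properties.CommutativeSemigroup ℤ.+-commutativeSemigroup
  using (x∙yz≈y∙xz; x∙yz≈yx∙z; xy∙z≈x∙zy)
open import Relation.Binary.PropositionalEquality
open import Relation.Nullary.Decidable using (does)
open import Relation.Nullary.Negation using (contradiction)

open import Defs

{-
φ reads P and Q' = flipBelow Q from left to right and only remembers a state (y, k): the
height y reached by Q and the number k of unmatched U steps of (P - Q')/2 so far. Every
step can be undone from the state after it, so φ together with its final state is a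
bijection between (initial state, P, Q) and (φ(P,Q), final state). Write (P̃, Q̃) = φ(P,Q).
Along the scan from (0, 0) one has h(Q̃) + 2k = h(P) and h(P) ≤ h(P̃); so on 𝓜 the final
state is (i - j, K) with h(Q̃) + 2K = i + j, which gives injectivity.

If -P ≤ Q ≤ P then |h(Q)| ≤ h(Q̃) throughout: |h(Q)| rises at most when Q' does, and Q̃
leaves Q' only at unmatched D steps, where k = 0 and Q̃ meets P. This puts φ(P,Q) in 𝓟.

Conversely, undo the scan of (P̃, Q̃) ∈ 𝓟 from the state (i - j, K), where K exists by
parity. Going backwards, Q̃ ≤ P̃ keeps h(P̃) - h(Q̃) - 2k ≥ 0, as this quantity only grows
at unmatched D steps, where k = 0; and Q̃ ≥ 0 keeps h(Q̃) ≥ |h(Q)| with equal parity. At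
the start these force k = 0 and y = 0, and then -P ≤ Q ≤ P.
-}

+-cancelʳ-≤ : ∀ {a b} s → a + s ≤ b + s → a ≤ b
+-cancelʳ-≤ {a} {b} s le = subst₂ _≤_ (cancel a) (cancel b) (ℤ.+-monoˡ-≤ (- s) le)
  where
  cancel : ∀ x → x + s + - s ≡ x
  cancel x = trans (ℤ.+-assoc x s (- s)) (trans (cong (_+_ x) (ℤ.+-inverseʳ s)) (ℤ.+-identityʳ x))

i+j-j≡i : ∀ i j → i + j - j ≡ i
i+j-j≡i i j = trans (ℤ.+-assoc i j (- j)) (trans (cong (_+_ i) (ℤ.+-inverseʳ j)) (ℤ.+-identityʳ i))

i-j+j≡i : ∀ i j → i - j + j ≡ i
i-j+j≡i i j = trans (ℤ.+-assoc i (- j) j) (trans (cong (_+_ i) (ℤ.+-inverseˡ j)) (ℤ.+-identityʳ i))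

∣i∣≤j⇒i≤j : ∀ {i j} → + ∣ i ∣ ≤ j → i ≤ j
∣i∣≤j⇒i≤j {+ n}      le = le
∣i∣≤j⇒i≤j { -[1+ n ]} le = ℤ.≤-trans -≤+ le

∣i∣≤j⇒-j≤i : ∀ {i j} → + ∣ i ∣ ≤ j → - j ≤ i
∣i∣≤j⇒-j≤i {+ n}      le = ℤ.≤-trans (ℤ.neg-mono-≤ le) ℤ.neg-≤-pos
∣i∣≤j⇒-j≤i { -[1+ n ]} le = ℤ.neg-mono-≤ le

-j≤i≤j⇒∣i∣≤j : ∀ {i j} → - j ≤ i → i ≤ j → + ∣ i ∣ ≤ j
-j≤i≤j⇒∣i∣≤j {+ n}      _  le = le
-j≤i≤j⇒∣i∣≤j { -[1+ n ]} le _  = ℤ.neg-cancel-≤ le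

*2≤0⇒≡0 : ∀ {k} → + (k * 2) ≤ + 0 → k ≡ 0
*2≤0⇒≡0 {zero}  _          = refl
*2≤0⇒≡0 {suc k} (+≤+ ())

even-gap : ∀ {a b} → a % 2 ≡ b % 2 → a ℕ.≤ b → ∃[ m ] a ℕ.+ m * 2 ≡ b
even-gap {a} {b} same a≤b = b / 2 ∸ a / 2 , (begin
  a ℕ.+ (b / 2 ∸ a / 2) * 2                    ≡⟨ cong (ℕ._+ (b / 2 ∸ a / 2) * 2) (m≡m%n+[m/n]*n a 2) ⟩
  a % 2 ℕ.+ a / 2 * 2 ℕ.+ (b / 2 ∸ a / 2) * 2  ≡⟨ ℕ.+-assoc (a % 2) _ _ ⟩
  a % 2 ℕ.+ (a / 2 * 2 ℕ.+ (b / 2 ∸ a / 2) * 2) ≡⟨ cong (a % 2 ℕ.+_) (sym (ℕ.*-distribʳ-+ 2 (a / 2) _)) ⟩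
  a % 2 ℕ.+ (a / 2 ℕ.+ (b / 2 ∸ a / 2)) * 2    ≡⟨ cong (λ t → a % 2 ℕ.+ t * 2) (ℕ.m+[n∸m]≡n (/-monoˡ-≤ 2 a≤b)) ⟩
  a % 2 ℕ.+ b / 2 * 2                          ≡⟨ cong (ℕ._+ b / 2 * 2) same ⟩
  b % 2 ℕ.+ b / 2 * 2                          ≡⟨ sym (m≡m%n+[m/n]*n b 2) ⟩
  b                                            ∎)
  where open ≡-Reasoning

path-parity : ∀ {n} (Q : Path n) → ∃[ t ] h Q + + (t * 2) ≡ + n
path-parity []          = 0 , refl
path-parity (true ∷ Q)  = let t , e = path-parity Q in
  t , trans (ℤ.+-assoc (+ 1) (h Q) _) (cong (_+_ (+ 1)) e)
path-parity (false ∷ Q) = let t , e = path-parity Q in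
  suc t , (begin
  - + 1 + h Q + (+ 2 + + (t * 2))   ≡⟨ ℤ.+-assoc (- + 1) (h Q) _ ⟩
  - + 1 + (h Q + (+ 2 + + (t * 2))) ≡⟨ cong (_+_ (- + 1)) (x∙yz≈y∙xz (h Q) (+ 2) _) ⟩
  - + 1 + (+ 2 + (h Q + + (t * 2))) ≡⟨ sym (ℤ.+-assoc (- + 1) (+ 2) (h Q + + (t * 2))) ⟩
  + 1 + (h Q + + (t * 2))           ≡⟨ cong (_+_ (+ 1)) e ⟩
  + 1 + + _                         ∎)
  where open ≡-Reasoning

height-even-gap : ∀ {n} m (Q : Path n) → m % 2 ≡ n % 2 → + 0 ≤ h Q → h Q ≤ + m →
  ∃[ K ] h Q + + (K * 2) ≡ + m
height-even-gap {n} m Q parity nonneg le =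
  let t , e = path-parity Q
      q+t*2≡n = ℤ.+-injective (trans (cong (_+ + (t * 2)) hq) e)
      sameParity = trans (sym ([m+kn]%n≡m%n q t 2)) (trans (cong (_% 2) q+t*2≡n) (sym parity))
      K , gap = even-gap sameParity (ℤ.drop‿+≤+ (subst (_≤ + m) (sym hq) le))
  in K , trans (cong (_+ + (K * 2)) (sym hq)) (cong +_ gap)
  where
  q  = ∣ h Q ∣
  hq = ℤ.0≤i⇒+∣i∣≡i nonneg

-- flipBelowFrom y (q ∷ Q) starts with flipIfNegative (y + stepH q) q, definitionally.
flipIfNegative : ℤ → Bool → Bool
flipIfNegative Y b = if does (Y <? + 0) then not b else b

flipIfNegative-involutive : ∀ Y b → flipIfNegative Y (flipIfNegative Y b) ≡ b
flipIfNegative-involutive Y b with does (Y <? + 0)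
... | true  = not-involutive b
... | false = refl

outP outQ : ℕ → Bool → Bool → Bool
outP k       true  _     = true
outP k       false false = false
outP zero    false true  = true
outP (suc k) false true  = false

outQ k       true  c     = c
outQ k       false false = false
outQ zero    false true  = false
outQ (suc k) false true  = true

nextK : ℕ → Bool → Bool → ℕ
nextK k       true  true  = k
nextK k       true  false = suc k
nextK k       false false = k
nextK zero    false true  = zero
nextK (suc k) false true  = k

flipUnmatchedD-∷ : ∀ {n} k p c (P T : Path n) →
  let r = flipUnmatchedD (nextK k p c) P T in
  flipUnmatchedD k (p ∷ P) (c ∷ T) ≡ (outP k p c ∷ proj₁ r , outQ k p c ∷ proj₂ r)
flipUnmatchedD-∷ k       true  true  P T = refl
flipUnmatchedD-∷ k       true  false P T = refl
flipUnmatchedD-∷ zero    false false P T = refl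
flipUnmatchedD-∷ (suc k) false false P T = refl
flipUnmatchedD-∷ zero    false true  P T = refl
flipUnmatchedD-∷ (suc k) false true  P T = refl

flippedP flippedQ : ∀ {n} → ℕ → Path n → Path n → Path n
flippedP k P T = proj₁ (flipUnmatchedD k P T)
flippedQ k P T = proj₂ (flipUnmatchedD k P T)

flippedP-∷ : ∀ {n} k p c (P T : Path n) → flippedP k (p ∷ P) (c ∷ T) ≡ outP k p c ∷ flippedP (nextK k p c) P T
flippedP-∷ k p c P T = cong proj₁ (flipUnmatchedD-∷ k p c P T)

flippedQ-∷ : ∀ {n} k p c (P T : Path n) → flippedQ k (p ∷ P) (c ∷ T) ≡ outQ k p c ∷ flippedQ (nextK k p c) P T
flippedQ-∷ k p c P T = cong proj₂ (flipUnmatchedD-∷ k p c P T)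

data MatchStep : ℕ → Bool → Bool → Set where
  unmatchedD : MatchStep 0 false true
  kept       : ∀ {k p c} → outP k p c ≡ p → outQ k p c ≡ c → MatchStep k p c

matchStep : ∀ k p c → MatchStep k p c
matchStep k       true  true  = kept refl refl
matchStep k       true  false = kept refl refl
matchStep k       false false = kept refl refl
matchStep zero    false true  = unmatchedD
matchStep (suc k) false true  = kept refl refl

outQ+nextK*2≡p+k*2 : ∀ k p c → stepH (outQ k p c) + + (nextK k p c * 2) ≡ stepH p + + (k * 2)
outQ+nextK*2≡p+k*2 k       true  true  = refl
outQ+nextK*2≡p+k*2 k       true  false = refl
outQ+nextK*2≡p+k*2 k       false false = refl
outQ+nextK*2≡p+k*2 zero    false true  = refl
outQ+nextK*2≡p+k*2 (suc k) false true  = refl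

stepH-outP : ∀ k p c → stepH p ≤ stepH (outP k p c)
stepH-outP k p c with matchStep k p c
... | unmatchedD = ℤ.neg-≤-pos
... | kept eP _  = ℤ.≤-reflexive (cong stepH (sym eP))

offset-nextK : ∀ v k p c → v + + (k * 2) + stepH p ≡ v + stepH (outQ k p c) + + (nextK k p c * 2)
offset-nextK v k p c = begin
  v + + (k * 2) + stepH p                       ≡⟨ xy∙z≈x∙zy v (+ (k * 2)) (stepH p) ⟩
  v + (stepH p + + (k * 2))                     ≡⟨ cong (_+_ v) (sym (outQ+nextK*2≡p+k*2 k p c)) ⟩
  v + (stepH (outQ k p c) + + (nextK k p c * 2)) ≡⟨ sym (ℤ.+-assoc v _ _) ⟩
  v + stepH (outQ k p c) + + (nextK k p c * 2)   ∎
  where open ≡-Reasoning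

-- Q' goes up exactly when |h(Q)| grows or when Q returns to 0 from below.
data AbsStep : ℤ → Bool → Set where
  away    : ∀ {y q} → ∣ y + stepH q ∣ ≡ suc ∣ y ∣ → flipIfNegative (y + stepH q) q ≡ true → AbsStep y q
  toward  : ∀ {y q} → ∣ y ∣ ≡ suc ∣ y + stepH q ∣ → flipIfNegative (y + stepH q) q ≡ false → AbsStep y q
  returns : AbsStep -[1+ 0 ] true

absStep : ∀ y q → AbsStep y q
absStep (+ zero)         true  = away refl refl
absStep (+ zero)         false = away refl refl
absStep (+ suc n)        true  = away (cong suc (ℕ.+-comm n 1)) refl
absStep (+ suc n)        false = toward refl refl
absStep -[1+ zero ]      true  = returns
absStep -[1+ zero ]      false = away refl refl
absStep -[1+ suc n ]     true  = toward refl refl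
absStep -[1+ suc n ]     false = away (cong (λ m → suc (suc (suc m))) (ℕ.+-identityʳ n)) refl

∣+stepH∣≤ : ∀ y q → + ∣ y + stepH q ∣ ≤ + ∣ y ∣ + stepH (flipIfNegative (y + stepH q) q)
∣+stepH∣≤ y q with absStep y q
... | away e f rewrite e | f = ℤ.≤-reflexive (cong +_ (ℕ.+-comm 1 ∣ y ∣))
... | toward e f rewrite e | f = ℤ.≤-refl
... | returns = +≤+ ℕ.z≤n

-- Heights along the scan

-- Opaque, so that R and the starting heights y and x can be inferred from an Along-type.
opaque
  Along : ∀ {n} → (ℤ → ℤ → Set) → ℤ → Path n → ℤ → Path n → Set
  Along R y Q x P = ∀ a → R (y + hAt Q a) (x + hAt P a)

module _ {R : ℤ → ℤ → Set} where
  opaque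
    unfolding Along

    along-intro : ∀ {n y x} {Q P : Path n} → (∀ a → R (y + hAt Q a) (x + hAt P a)) → Along R y Q x P
    along-intro r = r

    along-head : ∀ {n y x} {Q P : Path n} → Along R y Q x P → R y x
    along-head along = subst₂ R (ℤ.+-identityʳ _) (ℤ.+-identityʳ _) (along zero)

    along-tail : ∀ {n y x q p} {Q P : Path n} →
      Along R y (q ∷ Q) x (p ∷ P) → Along R (y + stepH q) Q (x + stepH p) P
    along-tail {y = y} {x} {q} {p} {Q} {P} along a =
      subst₂ R (sym (ℤ.+-assoc y (stepH q) (hAt Q a))) (sym (ℤ.+-assoc x (stepH p) (hAt P a))) (along (suc a))

    along-[] : ∀ {y x} → R y x → Along R y [] x []
    along-[] r zero = subst₂ R (sym (ℤ.+-identityʳ _)) (sym (ℤ.+-identityʳ _)) r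

    along-∷ : ∀ {n y x q p} {Q P : Path n} →
      R y x → Along R (y + stepH q) Q (x + stepH p) P → Along R y (q ∷ Q) x (p ∷ P)
    along-∷ r along zero    = subst₂ R (sym (ℤ.+-identityʳ _)) (sym (ℤ.+-identityʳ _)) r
    along-∷ {y = y} {x} {q} {p} {Q} {P} r along (suc a) =
      subst₂ R (ℤ.+-assoc y (stepH q) (hAt Q a)) (ℤ.+-assoc x (stepH p) (hAt P a)) (along a)

    along-from-0 : ∀ {n} {Q P : Path n} → (∀ a → R (hAt Q a) (hAt P a)) → Along R (+ 0) Q (+ 0) P
    along-from-0 r a = subst₂ R (sym (ℤ.+-identityˡ _)) (sym (ℤ.+-identityˡ _)) (r a)

    along-to-0 : ∀ {n} {Q P : Path n} → Along R (+ 0) Q (+ 0) P → ∀ a → R (hAt Q a) (hAt P a)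
    along-to-0 along a = subst₂ R (ℤ.+-identityˡ _) (ℤ.+-identityˡ _) (along a)

unmatchedUAt : ∀ {n} → ℕ → Path n → Path n → Fin (suc n) → ℕ
unmatchedUAt k P       T       zero    = k
unmatchedUAt k (p ∷ P) (c ∷ T) (suc a) = unmatchedUAt (nextK k p c) P T a

flippedQ-height : ∀ {n} k (P T : Path n) a →
  hAt (flippedQ k P T) a + + (unmatchedUAt k P T a * 2) ≡ hAt P a + + (k * 2)
flippedQ-height k P       T       zero    = refl
flippedQ-height k (p ∷ P) (c ∷ T) (suc a) = begin
  hAt (flippedQ k (p ∷ P) (c ∷ T)) (suc a) + K   ≡⟨ cong (λ A → hAt A (suc a) + K) (flippedQ-∷ k p c P T) ⟩
  stepH (outQ k p c) + Q̃ₐ + K                   ≡⟨ ℤ.+-assoc (stepH (outQ k p c)) Q̃ₐ K ⟩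
  stepH (outQ k p c) + (Q̃ₐ + K)                 ≡⟨ cong (_+_ (stepH (outQ k p c))) (flippedQ-height k′ P T a) ⟩
  stepH (outQ k p c) + (hAt P a + + (k′ * 2))    ≡⟨ x∙yz≈y∙xz (stepH (outQ k p c)) (hAt P a) (+ (k′ * 2)) ⟩
  hAt P a + (stepH (outQ k p c) + + (k′ * 2))    ≡⟨ cong (_+_ (hAt P a)) (outQ+nextK*2≡p+k*2 k p c) ⟩
  hAt P a + (stepH p + + (k * 2))                ≡⟨ x∙yz≈yx∙z (hAt P a) (stepH p) (+ (k * 2)) ⟩
  stepH p + hAt P a + + (k * 2)                  ∎
  where
  open ≡-Reasoning
  k′ = nextK k p c
  K  = + (unmatchedUAt k′ P T a * 2)
  Q̃ₐ = hAt (flippedQ k′ P T) a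

flippedP-above : ∀ {n} k (P T : Path n) a → hAt P a ≤ hAt (flippedP k P T) a
flippedP-above k P       T       zero    = ℤ.≤-refl
flippedP-above k (p ∷ P) (c ∷ T) (suc a) rewrite flippedP-∷ k p c P T =
  ℤ.+-mono-≤ (stepH-outP k p c) (flippedP-above (nextK k p c) P T a)

flippedQ-below : ∀ {n} (P T : Path n) a → hAt (flippedQ 0 P T) a ≤ hAt P a
flippedQ-below P T a = subst (hAt (flippedQ 0 P T) a ≤_) (trans (flippedQ-height 0 P T a) (ℤ.+-identityʳ (hAt P a)))
  (ℤ.i≤i+j (hAt (flippedQ 0 P T) a) (+ (unmatchedUAt 0 P T a * 2)))

Dominates : ℤ → ℤ → Set
Dominates y v = + ∣ y ∣ ≤ v

dominates-step : ∀ {k p c} y q v → + ∣ y + stepH q ∣ ≤ + ∣ y ∣ + stepH c → Dominates y v →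
  Dominates (y + stepH q) (v + stepH (outQ k p c) + + (nextK k p c * 2)) →
  Dominates (y + stepH q) (v + stepH (outQ k p c))
dominates-step {k} {p} {c} y q v yc yv next with matchStep k p c
... | unmatchedD = subst (Dominates (y + stepH q)) (ℤ.+-identityʳ _) next
... | kept _ eQ  = ℤ.≤-trans yc
  (subst (λ b → + ∣ y ∣ + stepH c ≤ v + stepH b) (sym eQ) (ℤ.+-monoˡ-≤ (stepH c) yv))

dominates-flippedQ : ∀ {n} y k v (P Q : Path n) →
  Along Dominates y Q (v + + (k * 2)) P → Dominates y v →
  Along Dominates y Q v (flippedQ k P (flipBelowFrom y Q))
dominates-flippedQ y k v []      []      _     yv = along-[] yv
dominates-flippedQ y k v (p ∷ P) (q ∷ Q) bound yv
  rewrite flippedQ-∷ k p (flipIfNegative (y + stepH q) q) P (flipBelowFrom (y + stepH q) Q) =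
  along-∷ yv (dominates-flippedQ (y + stepH q) (nextK k p c) (v + stepH (outQ k p c)) P Q bound′
    (dominates-step {k} {p} {c} y q v (∣+stepH∣≤ y q) yv (along-head bound′)))
  where
  c = flipIfNegative (y + stepH q) q
  bound′ : Along Dominates (y + stepH q) Q (v + stepH (outQ k p c) + + (nextK k p c * 2)) P
  bound′ = subst (λ x → Along Dominates (y + stepH q) Q x P) (offset-nextK v k p c) (along-tail bound)

unmatched-start-step : ∀ {k p c} v u → v ≤ u →
  v + stepH (outQ k p c) + + (nextK k p c * 2) ≤ u + stepH (outP k p c) → v + + (k * 2) ≤ u
unmatched-start-step {k} {p} {c} v u vu next with matchStep k p c
... | unmatchedD = subst (_≤ u) (sym (ℤ.+-identityʳ v)) vu
... | kept eP _  = +-cancelʳ-≤ (stepH p)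
  (subst₂ _≤_ (sym (offset-nextK v k p c)) (cong (λ b → u + stepH b) eP) next)

unmatched-start : ∀ {n} k v u (P T : Path n) →
  Along _≤_ v (flippedQ k P T) u (flippedP k P T) →
  v + h (flippedQ k P T) + + (unmatchedUAt k P T (fromℕ n) * 2) ≤ u + h (flippedP k P T) →
  v + + (k * 2) ≤ u
unmatched-start k v u []      []      _     final =
  subst₂ (λ s t → s + + (k * 2) ≤ t) (ℤ.+-identityʳ v) (ℤ.+-identityʳ u) final
unmatched-start k v u (p ∷ P) (c ∷ T) below final
  rewrite flippedQ-∷ k p c P T | flippedP-∷ k p c P T =
  unmatched-start-step {k} {p} {c} v u (along-head below)
    (unmatched-start (nextK k p c) (v + stepH (outQ k p c)) (u + stepH (outP k p c)) P T (along-tail below)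
      (subst₂ (λ s t → s + + (unmatchedUAt (nextK k p c) P T (fromℕ _) * 2) ≤ t)
        (sym (ℤ.+-assoc v _ _)) (sym (ℤ.+-assoc u _ _)) final))

-- h_a(Q̃) ≥ |h_a(Q)| with equal parity: the invariant carried by the backward scan.
AboveEven : ℤ → ℤ → Set
AboveEven y v = ∃[ m ] v ≡ + (∣ y ∣ ℕ.+ m * 2)

aboveEven-down : ∀ y q w → AboveEven (y + stepH q) (+ w + stepH false) → AboveEven y (+ w)
aboveEven-down y q zero    (m , ())
aboveEven-down y q (suc w) (m , e) with absStep y q
... | away a _ = suc m , cong +_ (begin
  suc w                            ≡⟨ cong suc (ℤ.+-injective e) ⟩
  suc (∣ y + stepH q ∣ ℕ.+ m * 2)  ≡⟨ cong (λ t → suc (t ℕ.+ m * 2)) a ⟩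
  suc (suc (∣ y ∣ ℕ.+ m * 2))      ≡⟨ sym (trans (ℕ.+-suc ∣ y ∣ _) (cong suc (ℕ.+-suc ∣ y ∣ _))) ⟩
  ∣ y ∣ ℕ.+ suc m * 2              ∎)
  where open ≡-Reasoning
... | toward a _ = m , cong +_ (trans (cong suc (ℤ.+-injective e)) (cong (ℕ._+ m * 2) (sym a)))
... | returns    = m , cong (λ t → + suc t) (ℤ.+-injective e)

aboveEven-kept : ∀ y q w →
  AboveEven (y + stepH q) (+ w + stepH (flipIfNegative (y + stepH q) q)) → AboveEven y (+ w)
aboveEven-kept y q w (m , e) with absStep y q
... | away a f = m , cong +_ (ℕ.suc-injective (begin
  suc w                            ≡⟨ ℕ.+-comm 1 w ⟩
  w ℕ.+ 1                          ≡⟨ ℤ.+-injective (trans (cong (λ b → + w + stepH b) (sym f)) e) ⟩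
  ∣ y + stepH q ∣ ℕ.+ m * 2        ≡⟨ cong (ℕ._+ m * 2) a ⟩
  suc (∣ y ∣ ℕ.+ m * 2)            ∎))
  where open ≡-Reasoning
... | toward a f = aboveEven-down y q w (m , trans (cong (λ b → + w + stepH b) (sym f)) e)
... | returns with m
...   | zero  = contradiction (ℕ.m+n≡0⇒n≡0 w (ℤ.+-injective e)) λ ()
...   | suc m = m , cong +_ (ℕ.suc-injective (trans (ℕ.+-comm 1 w) (ℤ.+-injective e)))

aboveEven⇒dominates : ∀ {y v} → AboveEven y v → Dominates y v
aboveEven⇒dominates {y} (m , refl) = +≤+ (ℕ.m≤m+n ∣ y ∣ (m * 2))

aboveEven-0⇒≡0 : ∀ {y} → AboveEven y (+ 0) → y ≡ + 0
aboveEven-0⇒≡0 {y} (m , e) = ℤ.∣i∣≡0⇒i≡0 (ℕ.m+n≡0⇒m≡0 ∣ y ∣ (sym (ℤ.+-injective e)))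

aboveEven-step : ∀ {k p c} y q v → c ≡ flipIfNegative (y + stepH q) q → + 0 ≤ v →
  AboveEven (y + stepH q) (v + stepH (outQ k p c)) → AboveEven y v
aboveEven-step {k} {p} {c} y q _ e (+≤+ {n = w} _) above with matchStep k p c
... | unmatchedD = aboveEven-down y q w above
... | kept _ eQ  = aboveEven-kept y q w (subst (λ b → AboveEven (y + stepH q) (+ w + stepH b)) (trans eQ e) above)

aboveEven-flippedQ : ∀ {n} y k v (P Q : Path n) →
  Along (λ _ t → + 0 ≤ t) y Q v (flippedQ k P (flipBelowFrom y Q)) →
  AboveEven (y + h Q) (v + h (flippedQ k P (flipBelowFrom y Q))) →
  Along AboveEven y Q v (flippedQ k P (flipBelowFrom y Q))
aboveEven-flippedQ y k v []      []      _      final =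
  along-[] (subst₂ AboveEven (ℤ.+-identityʳ y) (ℤ.+-identityʳ v) final)
aboveEven-flippedQ y k v (p ∷ P) (q ∷ Q) nonneg final
  rewrite flippedQ-∷ k p (flipIfNegative (y + stepH q) q) P (flipBelowFrom (y + stepH q) Q) =
  along-∷ (aboveEven-step {k} {p} y q v refl (along-head nonneg) (along-head tail)) tail
  where
  c = flipIfNegative (y + stepH q) q
  tail = aboveEven-flippedQ (y + stepH q) (nextK k p c) (v + stepH (outQ k p c)) P Q
    (along-tail nonneg) (subst₂ AboveEven (sym (ℤ.+-assoc y _ _)) (sym (ℤ.+-assoc v _ _)) final)

aboveEven-end : ∀ {i j K} v → j ℕ.≤ i → + 0 ≤ v → + i - + j ≤ v → v + + (K * 2) ≡ + i + + j →
  AboveEven (+ i - + j) v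
aboveEven-end {i} {j} {K} _ j≤i (+≤+ {n = q} _) i-j≤v count =
  let m , gap = even-gap sameParity (ℤ.drop‿+≤+ (subst (_≤ + q) i-j i-j≤v))
  in subst (λ z → AboveEven z (+ q)) (sym i-j) (m , cong +_ (sym gap))
  where
  i-j : + i - + j ≡ + (i ∸ j)
  i-j = trans (ℤ.m-n≡m⊖n i j) (ℤ.⊖-≥ j≤i)
  i∸j+j*2 : i ∸ j ℕ.+ j * 2 ≡ i ℕ.+ j
  i∸j+j*2 = begin
    i ∸ j ℕ.+ j * 2         ≡⟨ cong (i ∸ j ℕ.+_) (trans (ℕ.*-comm j 2) (cong (j ℕ.+_) (ℕ.+-identityʳ j))) ⟩
    i ∸ j ℕ.+ (j ℕ.+ j)     ≡⟨ sym (ℕ.+-assoc (i ∸ j) j j) ⟩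
    i ∸ j ℕ.+ j ℕ.+ j       ≡⟨ cong (ℕ._+ j) (ℕ.m∸n+n≡m j≤i) ⟩
    i ℕ.+ j                 ∎
    where open ≡-Reasoning
  sameParity : (i ∸ j) % 2 ≡ q % 2
  sameParity = trans (sym ([m+kn]%n≡m%n (i ∸ j) j 2))
    (trans (cong (_% 2) (trans i∸j+j*2 (sym (ℤ.+-injective count)))) ([m+kn]%n≡m%n q K 2))

-- Undoing the scan

match : ℕ → Bool → Bool → (Bool × Bool) × ℕ
match k p c = (outP k p c , outQ k p c) , nextK k p c

unmatch : (Bool × Bool) × ℕ → ℕ × Bool × Bool
unmatch ((true  , true)  , k′)     = k′ , true , true
unmatch ((false , false) , k′)     = k′ , false , false
unmatch ((false , true)  , k′)     = suc k′ , false , true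
unmatch ((true  , false) , zero)   = zero , false , true
unmatch ((true  , false) , suc k′) = k′ , true , false

unmatch-match : ∀ k p c → unmatch (match k p c) ≡ (k , p , c)
unmatch-match k       true  true  = refl
unmatch-match k       true  false = refl
unmatch-match k       false false = refl
unmatch-match zero    false true  = refl
unmatch-match (suc k) false true  = refl

match-unmatch : ∀ o → let k , p , c = unmatch o in match k p c ≡ o
match-unmatch ((true  , true)  , k′)     = refl
match-unmatch ((false , false) , k′)     = refl
match-unmatch ((false , true)  , k′)     = refl
match-unmatch ((true  , false) , zero)   = refl
match-unmatch ((true  , false) , suc k′) = refl

step : ℤ × ℕ → Bool × Bool → (Bool × Bool) × ℤ × ℕ
step (y , k) (p , q) = let o , k′ = match k p (flipIfNegative (y + stepH q) q) in o , y + stepH q , k′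

unstep : Bool × Bool → ℤ × ℕ → (ℤ × ℕ) × Bool × Bool
unstep o (y′ , k′) = let k , p , c = unmatch (o , k′) ; q = flipIfNegative y′ c in (y′ - stepH q , k) , p , q

unstep-step : ∀ s i → let o , s′ = step s i in unstep o s′ ≡ (s , i)
unstep-step (y , k) (p , q)
  rewrite unmatch-match k p (flipIfNegative (y + stepH q) q)
        | flipIfNegative-involutive (y + stepH q) q
        | i+j-j≡i y (stepH q) = refl

step-unstep : ∀ o s′ → let s , i = unstep o s′ in step s i ≡ (o , s′)
step-unstep o (y′ , k′) with unmatch (o , k′) | match-unmatch (o , k′)
... | k , p , c | matched
  rewrite i-j+j≡i y′ (stepH (flipIfNegative y′ c))
        | flipIfNegative-involutive y′ c = cong (λ (o″ , k″) → o″ , y′ , k″) matched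

scan : ∀ {n} → (ℤ × ℕ) × Path n × Path n → (Path n × Path n) × ℤ × ℕ
scan {n} ((y , k) , P , Q) = flipUnmatchedD k P T , y + h Q , unmatchedUAt k P T (fromℕ n)
  where T = flipBelowFrom y Q

consOut : ∀ {n} → Bool × Bool → (Path n × Path n) × ℤ × ℕ → (Path (suc n) × Path (suc n)) × ℤ × ℕ
consOut (a , b) ((A , B) , s) = (a ∷ A , b ∷ B) , s

consIn : ∀ {n} → Bool × Bool → (ℤ × ℕ) × Path n × Path n → (ℤ × ℕ) × Path (suc n) × Path (suc n)
consIn o (s′ , P , Q) = let s , p , q = unstep o s′ in s , p ∷ P , q ∷ Q

unscan : ∀ {n} → (Path n × Path n) × ℤ × ℕ → (ℤ × ℕ) × Path n × Path n
unscan (([]    , [])    , s) = s , [] , []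
unscan ((a ∷ A , b ∷ B) , s) = consIn (a , b) (unscan ((A , B) , s))

scan-∷ : ∀ {n} s i (P Q : Path n) →
  scan (s , proj₁ i ∷ P , proj₂ i ∷ Q) ≡ consOut (proj₁ (step s i)) (scan (proj₂ (step s i) , P , Q))
scan-∷ {n} (y , k) (p , q) P Q = cong₂ _,_ (flipUnmatchedD-∷ k p c P T)
  (cong (_, unmatchedUAt (nextK k p c) P T (fromℕ n)) (sym (ℤ.+-assoc y (stepH q) (h Q))))
  where
  c = flipIfNegative (y + stepH q) q
  T = flipBelowFrom (y + stepH q) Q

unscan-scan : ∀ {n} (r : (ℤ × ℕ) × Path n × Path n) → unscan (scan r) ≡ r
unscan-scan ((y , k) , [] , []) = cong (λ y → (y , k) , [] , []) (ℤ.+-identityʳ y)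
unscan-scan (s , p ∷ P , q ∷ Q) = begin
  unscan (scan (s , p ∷ P , q ∷ Q))          ≡⟨ cong unscan (scan-∷ s (p , q) P Q) ⟩
  consIn o (unscan (scan (s′ , P , Q)))      ≡⟨ cong (consIn o) (unscan-scan (s′ , P , Q)) ⟩
  consIn o (s′ , P , Q)
    ≡⟨ cong (λ (s₀ , p₀ , q₀) → s₀ , p₀ ∷ P , q₀ ∷ Q) (unstep-step s (p , q)) ⟩
  s , p ∷ P , q ∷ Q                          ∎
  where
  open ≡-Reasoning
  o  = proj₁ (step s (p , q))
  s′ = proj₂ (step s (p , q))

scan-unscan : ∀ {n} (o : (Path n × Path n) × ℤ × ℕ) → scan (unscan o) ≡ o
scan-unscan (([] , []) , (y , k)) = cong (λ y → ([] , []) , y , k) (ℤ.+-identityʳ y)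
scan-unscan ((a ∷ A , b ∷ B) , s″) = begin
  scan (s , p ∷ P , q ∷ Q)                                   ≡⟨ scan-∷ s (p , q) P Q ⟩
  consOut (proj₁ (step s (p , q))) (scan (proj₂ (step s (p , q)) , P , Q))
    ≡⟨ cong (λ (o , s₁) → consOut o (scan (s₁ , P , Q))) (step-unstep (a , b) s′) ⟩
  consOut (a , b) (scan (unscan ((A , B) , s″)))
    ≡⟨ cong (consOut (a , b)) (scan-unscan ((A , B) , s″)) ⟩
  (a ∷ A , b ∷ B) , s″                                       ∎
  where
  open ≡-Reasoning
  s′ = proj₁ (unscan ((A , B) , s″))
  P  = proj₁ (proj₂ (unscan ((A , B) , s″)))
  Q  = proj₂ (proj₂ (unscan ((A , B) , s″)))
  s  = proj₁ (unstep (a , b) s′)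
  p  = proj₁ (proj₂ (unstep (a , b) s′))
  q  = proj₂ (proj₂ (unstep (a , b) s′))

pending-at-end : ∀ {n i j} {P Q : Path n} → InM n i j P Q →
  h (proj₂ (φ P Q)) + + (unmatchedUAt 0 P (flipBelow Q) (fromℕ n) * 2) ≡ + i + + j
pending-at-end {n} {P = P} {Q} (_ , _ , hP , _) =
  trans (flippedQ-height 0 P (flipBelow Q) (fromℕ n)) (trans (ℤ.+-identityʳ (h P)) hP)

φ-InP : ∀ {n i j} (P Q : Path n) → InM n i j P Q → InP n i j (proj₁ (φ P Q)) (proj₂ (φ P Q))
φ-InP {n} {i} {j} P Q (negBelow , below , hP , hQ) =
  (λ a → ℤ.≤-trans (+≤+ ℕ.z≤n) (dominated a)) ,
  (λ a → ℤ.≤-trans (flippedQ-below P T a) (flippedP-above 0 P T a)) ,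
  subst (_≤ h Q̃) hQ (ℤ.≤-trans (∣i∣≤j⇒i≤j {h Q} ℤ.≤-refl) (dominated (fromℕ n))) ,
  subst (h Q̃ ≤_) hP (flippedQ-below P T (fromℕ n)) ,
  subst (_≤ h (proj₁ (φ P Q))) hP (flippedP-above 0 P T (fromℕ n))
  where
  T  = flipBelow Q
  Q̃  = proj₂ (φ P Q)
  dominated : ∀ a → + ∣ hAt Q a ∣ ≤ hAt Q̃ a
  dominated = along-to-0 (dominates-flippedQ (+ 0) 0 (+ 0) P Q
    (along-from-0 (λ a → -j≤i≤j⇒∣i∣≤j (negBelow a) (below a))) (+≤+ ℕ.z≤n))

φ-injective : ∀ {n i j} (P Q P₁ Q₁ : Path n) → InM n i j P Q → InM n i j P₁ Q₁ →
  φ P Q ≡ φ P₁ Q₁ → P ≡ P₁ × Q ≡ Q₁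
φ-injective {n} {i} {j} P Q P₁ Q₁ inM@(_ , _ , _ , hQ) inM₁@(_ , _ , _ , hQ₁) eq =
  cong (λ r → proj₁ (proj₂ r)) same , cong (λ r → proj₂ (proj₂ r)) same
  where
  K  = unmatchedUAt 0 P (flipBelow Q) (fromℕ n)
  K₁ = unmatchedUAt 0 P₁ (flipBelow Q₁) (fromℕ n)
  open ≡-Reasoning
  sameK : K ≡ K₁
  sameK = ℕ.*-cancelʳ-≡ K K₁ 2 (ℤ.+-injective (∙-cancelˡ (h (proj₂ (φ P Q))) _ _ (begin
    h (proj₂ (φ P Q)) + + (K * 2)    ≡⟨ pending-at-end {i = i} {j} inM ⟩
    + i + + j                        ≡⟨ sym (pending-at-end {i = i} {j} inM₁) ⟩
    h (proj₂ (φ P₁ Q₁)) + + (K₁ * 2) ≡⟨ cong (λ r → h (proj₂ r) + + (K₁ * 2)) (sym eq) ⟩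
    h (proj₂ (φ P Q)) + + (K₁ * 2)   ∎)))
  sameHeight : + 0 + h Q ≡ + 0 + h Q₁
  sameHeight = cong (_+_ (+ 0)) (trans hQ (sym hQ₁))
  same : ((+ 0 , 0) , P , Q) ≡ ((+ 0 , 0) , P₁ , Q₁)
  same = begin
    (+ 0 , 0) , P , Q                   ≡⟨ sym (unscan-scan _) ⟩
    unscan (scan ((+ 0 , 0) , P , Q))   ≡⟨ cong unscan (cong₂ _,_ eq (cong₂ _,_ sameHeight sameK)) ⟩
    unscan (scan ((+ 0 , 0) , P₁ , Q₁)) ≡⟨ unscan-scan _ ⟩
    (+ 0 , 0) , P₁ , Q₁                 ∎

preimage-start : ∀ {n i j} y k (P Q : Path n) → j ℕ.≤ i →
  InP n i j (flippedP k P (flipBelowFrom y Q)) (flippedQ k P (flipBelowFrom y Q)) →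
  h (flippedQ k P (flipBelowFrom y Q)) + + (unmatchedUAt k P (flipBelowFrom y Q) (fromℕ n) * 2) ≡ + i + + j →
  y + h Q ≡ + i - + j →
  y ≡ + 0 × k ≡ 0 × Along AboveEven y Q (+ 0) (flippedQ k P (flipBelowFrom y Q))
preimage-start {n} {i} {j} y k P Q j≤i (nonneg , below , i-j≤ , _ , i+j≤) count hQ =
  aboveEven-0⇒≡0 (along-head above) , k≡0 , above
  where
  T = flipBelowFrom y Q
  above : Along AboveEven y Q (+ 0) (flippedQ k P T)
  above = aboveEven-flippedQ y k (+ 0) P Q
    (along-intro λ a → subst (+ 0 ≤_) (sym (ℤ.+-identityˡ _)) (nonneg a))
    (subst₂ AboveEven (sym hQ) (sym (ℤ.+-identityˡ (h (flippedQ k P T))))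
      (aboveEven-end {i} {j} {unmatchedUAt k P T (fromℕ n)} _ j≤i (nonneg (fromℕ n)) i-j≤ count))
  k≡0 : k ≡ 0
  k≡0 = *2≤0⇒≡0 (unmatched-start k (+ 0) (+ 0) P T (along-from-0 below)
    (subst₂ (λ a b → a + + (unmatchedUAt k P T (fromℕ n) * 2) ≤ b)
      (sym (ℤ.+-identityˡ (h (flippedQ k P T)))) (sym (ℤ.+-identityˡ (h (flippedP k P T))))
      (ℤ.≤-trans (ℤ.≤-reflexive count) i+j≤)))

preimage-in-M : ∀ {n i j} (P Q : Path n) →
  Along AboveEven (+ 0) Q (+ 0) (proj₂ (φ P Q)) →
  h (proj₂ (φ P Q)) + + (unmatchedUAt 0 P (flipBelow Q) (fromℕ n) * 2) ≡ + i + + j →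
  + 0 + h Q ≡ + i - + j → InM n i j P Q
preimage-in-M {n} P Q above count hQ =
  (λ a → ∣i∣≤j⇒-j≤i (dominated a)) , (λ a → ∣i∣≤j⇒i≤j (dominated a)) ,
  trans (sym (ℤ.+-identityʳ (h P))) (trans (sym (flippedQ-height 0 P (flipBelow Q) (fromℕ n))) count) ,
  trans (sym (ℤ.+-identityˡ (h Q))) hQ
  where
  dominated : ∀ a → + ∣ hAt Q a ∣ ≤ hAt P a
  dominated a = ℤ.≤-trans (aboveEven⇒dominates {hAt Q a} (along-to-0 above a)) (flippedQ-below P (flipBelow Q) a)

φ-onto : ∀ {n i j} → j ℕ.≤ i → (i ℕ.+ j) % 2 ≡ n % 2 → (P′ Q′ : Path n) → InP n i j P′ Q′ →
  Σ (Path n) λ P → Σ (Path n) λ Q → InM n i j P Q × φ P Q ≡ (P′ , Q′)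
φ-onto {n} {i} {j} j≤i parity P′ Q′ inP@(nonneg , _ , _ , ≤i+j , _) =
  let scanned = scan-unscan end
  in preimage _ _ _ _ (cong proj₁ scanned) (cong (λ r → proj₁ (proj₂ r)) scanned)
       (cong (λ r → proj₂ (proj₂ r)) scanned)
  where
  pending = height-even-gap (i ℕ.+ j) Q′ parity (nonneg (fromℕ n)) ≤i+j
  K = proj₁ pending
  end = (P′ , Q′) , + i - + j , K
  count : ∀ y k (P Q : Path n) → flipUnmatchedD k P (flipBelowFrom y Q) ≡ (P′ , Q′) →
    unmatchedUAt k P (flipBelowFrom y Q) (fromℕ n) ≡ K →
    h (flippedQ k P (flipBelowFrom y Q)) + + (unmatchedUAt k P (flipBelowFrom y Q) (fromℕ n) * 2) ≡ + i + + j
  count y k P Q outputs final = trans (cong₂ (λ B K′ → h B + + (K′ * 2)) (cong proj₂ outputs) final) (proj₂ pending)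
  preimage : ∀ y k (P Q : Path n) → flipUnmatchedD k P (flipBelowFrom y Q) ≡ (P′ , Q′) →
    y + h Q ≡ + i - + j → unmatchedUAt k P (flipBelowFrom y Q) (fromℕ n) ≡ K →
    Σ (Path n) λ P → Σ (Path n) λ Q → InM n i j P Q × φ P Q ≡ (P′ , Q′)
  preimage y k P Q outputs hQ final
    with preimage-start {n} {i} {j} y k P Q j≤i (subst (λ (A , B) → InP n i j A B) (sym outputs) inP)
           (count y k P Q outputs final) hQ
  ... | refl , refl , above = P , Q , preimage-in-M {n} {i} {j} P Q above (count (+ 0) 0 P Q outputs final) hQ , outputs

-- The hypothesis i + j ≤ n only makes the two sets non-empty; the bijection does not need it.
theorem2p1 : (n i j : ℕ) → j ℕ.≤ i → i ℕ.+ j ℕ.≤ n → (i ℕ.+ j) % 2 ≡ n % 2 →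
    ((P Q : Path n) → InM n i j P Q →
    Σ (Path n) λ P' → Σ (Path n) λ Q' → φ P Q ≡ (P' , Q') × InP n i j P' Q')
    × ((P Q P₁ Q₁ : Path n) → InM n i j P Q → InM n i j P₁ Q₁ →
    φ P Q ≡ φ P₁ Q₁ → (P ≡ P₁) × (Q ≡ Q₁))
    × ((P' Q' : Path n) → InP n i j P' Q' →
    Σ (Path n) λ P → Σ (Path n) λ Q → InM n i j P Q × φ P Q ≡ (P' , Q'))
theorem2p1 n i j j≤i _ parity =
  (λ P Q inM → proj₁ (φ P Q) , proj₂ (φ P Q) , refl , φ-InP {n} {i} {j} P Q inM) ,
  φ-injective {n} {i} {j} ,
  φ-onto j≤i parity
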